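{- Let $g\ge1$ and $0\le c\le\lfloor g/2\rfloor$ be integers and, for an indeterminate $p$, put \[L_{g,p^c}=\prod_{i=1}^{g-2c}(p^i+(-1)^i)\cdot\prod_{i=1}^c(p^{4i-2}-1)\cdot\frac{\prod_{i=1}^g(p^{2i}-1)}{\prod_{i=1}^{2c}(p^{2i}-1)\prod_{i=1}^{g-2c}(p^{2i}-1)}.\] Then $L_{g,p^c}$ is a polynomial in $p$ with coefficients in $\mathbb{Z}$, of degree $(g^2+4gc-8c^2+g-2c)/2$. Moreover, as $c$ ranges over $0\le c\le\lfloor g/2\rfloor$, the minimal degree occurs precisely when $c=0$ if $g$ is odd, and precisely when $c=g/2$ if $g$ is even. -}

module Defs where

open import Data.Nat as ℕ using (ℕ; zero; suc; _∸_; _≤_)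
open import Data.Nat.DivMod using (_/_)
open import Data.Integer as ℤ using (ℤ; +_; -_)
open import Data.List using (List; []; _∷_; length; map; replicate; _++_)
open import Relation.Binary.PropositionalEquality using (_≡_)
open import Data.Product using (Σ)

-- Polynomials over ℤ in one indeterminate p, as coefficient lists
-- (lowest degree first). Trailing zeros are allowed; equality is taken
-- modulo trailing zeros (see _≈P_).
Poly : Set
Poly = List ℤ

infixl 6 _+P_
infixl 7 _*P_

_+P_ : Poly → Poly → Poly
[]      +P q       = q
(a ∷ p) +P []      = a ∷ p
(a ∷ p) +P (b ∷ q) = (a ℤ.+ b) ∷ (p +P q)

_*P_ : Poly → Poly → Poly
[]      *P q = []
(a ∷ p) *P q = map (a ℤ.*_) q +P ((+ 0) ∷ (p *P q))

cons′ : ℤ → Poly → Poly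
cons′ (+ zero) [] = []
cons′ a        xs = a ∷ xs

trim : Poly → Poly
trim []      = []
trim (a ∷ p) = cons′ a (trim p)

_≈P_ : Poly → Poly → Set
p ≈P q = trim p ≡ trim q

-- degree (the zero polynomial is given degree 0; irrelevant here)
degree : Poly → ℕ
degree p = length (trim p) ∸ 1

const : ℤ → Poly
const a = a ∷ []

X^ : ℕ → Poly
X^ k = replicate k (+ 0) ++ ((+ 1) ∷ [])

negOnePow : ℕ → ℤ
negOnePow zero    = + 1
negOnePow (suc n) = - negOnePow n

prodP : ℕ → (ℕ → Poly) → Poly
prodP zero    f = const (+ 1)
prodP (suc n) f = prodP n f *P f (suc n)

fA : ℕ → Poly
fA i = X^ i +P const (negOnePow i)

fB : ℕ → Poly
fB i = X^ (4 ℕ.* i ∸ 2) +P const (- (+ 1))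

fC : ℕ → Poly
fC i = X^ (2 ℕ.* i) +P const (- (+ 1))

numL : ℕ → ℕ → Poly
numL g c = prodP (g ∸ 2 ℕ.* c) fA *P prodP c fB *P prodP g fC

denL : ℕ → ℕ → Poly
denL g c = prodP (2 ℕ.* c) fC *P prodP (g ∸ 2 ℕ.* c) fC

-- "L is the polynomial L_{g,p^c}", i.e. L · den = num in ℤ[p]
-- (the denominator is a nonzero polynomial, so L is unique)
IsL : ℕ → ℕ → Poly → Set
IsL g c L = (L *P denL g c) ≈P numL g c

degFormula : ℕ → ℕ → ℕ
degFormula g c =
  (g ℕ.* g ℕ.+ 4 ℕ.* g ℕ.* c ℕ.+ g ∸ (8 ℕ.* c ℕ.* c ℕ.+ 2 ℕ.* c)) / 2

MinDeg : ℕ → ℕ → Set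
MinDeg g c = (L : Poly) → IsL g c L →
  (c' : ℕ) → c' ≤ g / 2 → (L' : Poly) → IsL g c' L' → degree L ≤ degree L'

-- The quotient in L_{g,p^c} is a Gaussian binomial in q = p²: writing C n for
-- ∏_{i=1}^n (p^{2i} − 1), the q-Pascal recurrence gives polynomials G a b with
-- G a b · C a · C b = C (a + b), so L = ∏ (p^i + (−1)^i) · ∏ (p^{4i−2} − 1) · G (2c) (g − 2c).
-- All factors are monic, so degrees add under multiplication and
-- deg L = deg(numerator) − deg(denominator), which is the stated formula.
-- As a function of c, for g = 2m + 1 the degree exceeds its value at c = 0 by c (4 (m − c) + 1), and
-- for g = 2m it exceeds its value at c = m by (m − c) (4c + 1); each excess vanishes only at the
-- claimed minimiser.

module Submission where

open import Defs
open import Algebra.Bundles using (AbelianGroup; CommutativeRing)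
import Algebra.Properties.CommutativeSemigroup as CommutativeSemigroupProperties
open import Algebra.Structures using (IsAbelianGroup)
open import Data.Empty using (⊥-elim)
open import Data.Integer as ℤ using (ℤ; +_; -_; -[1+_])
import Data.Integer.Properties as ℤ
open import Data.List using ([]; _∷_; _∷ʳ_; length; map; replicate)
open import Data.List.Properties using (length-map; length-replicate; map-++)
open import Data.Maybe using (Maybe; just; nothing)
open import Data.Nat using (ℕ; zero; suc; NonZero; _+_; _*_; _∸_; _≤_; z≤n; s≤s; _/_; _%_)
open import Data.Nat.DivMod using (m*n/n≡m; m/n*n≤m; m≡m%n+[m/n]*n)
open import Data.Nat.Properties
open import Data.Nat.Tactic.RingSolver using (solve-∀)
open import Data.Product using (Σ; ∃; _×_; _,_)
open import Data.Sum using (_⊎_; inj₁; inj₂; [_,_]′)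
open import Function.Bundles using (_⇔_; mk⇔)
open import Function.Properties.Equivalence using () renaming (trans to ⇔-trans)
open import Level using (0ℓ)
open import Relation.Binary.PropositionalEquality
import Relation.Binary.Reasoning.Setoid as SetoidReasoning
open import Relation.Nullary using (¬_; yes; no)
import Tactic.RingSolver.NonReflective as NonReflectiveRingSolver
import Tactic.RingSolver.Core.AlmostCommutativeRing as ACR

-- The ring of polynomials

coeff : Poly → ℕ → ℤ
coeff []      n       = + 0
coeff (a ∷ p) zero    = a
coeff (a ∷ p) (suc n) = coeff p n

-- Coefficientwise equality: unlike _≈P_, it is plainly a congruence for _+P_ and _*P_.
infix 4 _≃_
record _≃_ (p q : Poly) : Set where
  constructor coeffwise
  field coeff-≡ : ∀ n → coeff p n ≡ coeff q n
open _≃_ public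

≃-refl : ∀ {p} → p ≃ p
≃-refl = coeffwise λ _ → refl

≃-reflexive : ∀ {p q} → p ≡ q → p ≃ q
≃-reflexive refl = ≃-refl

≃-sym : ∀ {p q} → p ≃ q → q ≃ p
≃-sym e = coeffwise λ n → sym (coeff-≡ e n)

≃-trans : ∀ {p q r} → p ≃ q → q ≃ r → p ≃ r
≃-trans e f = coeffwise λ n → trans (coeff-≡ e n) (coeff-≡ f n)

∷-cong : ∀ {a b p q} → a ≡ b → p ≃ q → a ∷ p ≃ b ∷ q
∷-cong a≡b e = coeffwise λ { zero → a≡b ; (suc n) → coeff-≡ e n }

≃-tail : ∀ {a b p q} → a ∷ p ≃ b ∷ q → p ≃ q
≃-tail e = coeffwise λ n → coeff-≡ e (suc n)

≃[]-tail : ∀ {a p} → a ∷ p ≃ [] → p ≃ []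
≃[]-tail e = coeffwise λ n → coeff-≡ e (suc n)

-P_ : Poly → Poly
-P p = map ℤ.-_ p

coeff-+P : ∀ p q n → coeff (p +P q) n ≡ coeff p n ℤ.+ coeff q n
coeff-+P []      q       n       = sym (ℤ.+-identityˡ _)
coeff-+P (a ∷ p) []      n       = sym (ℤ.+-identityʳ _)
coeff-+P (a ∷ p) (b ∷ q) zero    = refl
coeff-+P (a ∷ p) (b ∷ q) (suc n) = coeff-+P p q n

coeff-map : ∀ f → f (+ 0) ≡ + 0 → ∀ p n → coeff (map f p) n ≡ f (coeff p n)
coeff-map f f0 []      n       = sym f0
coeff-map f f0 (a ∷ p) zero    = refl
coeff-map f f0 (a ∷ p) (suc n) = coeff-map f f0 p n

infixr 7 _·P_
_·P_ : ℤ → Poly → Poly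
a ·P q = map (a ℤ.*_) q

coeff-·P : ∀ a q n → coeff (a ·P q) n ≡ a ℤ.* coeff q n
coeff-·P a = coeff-map (a ℤ.*_) (ℤ.*-zeroʳ a)

0∷[]≃[] : + 0 ∷ [] ≃ []
0∷[]≃[] = coeffwise λ { zero → refl ; (suc n) → refl }

+P-cong : ∀ {p p′ q q′} → p ≃ p′ → q ≃ q′ → p +P q ≃ p′ +P q′
+P-cong {p} {p′} {q} {q′} e f = coeffwise λ n → begin
  coeff (p +P q) n            ≡⟨ coeff-+P p q n ⟩
  coeff p n ℤ.+ coeff q n     ≡⟨ cong₂ ℤ._+_ (coeff-≡ e n) (coeff-≡ f n) ⟩
  coeff p′ n ℤ.+ coeff q′ n   ≡⟨ coeff-+P p′ q′ n ⟨
  coeff (p′ +P q′) n          ∎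
  where open ≡-Reasoning

+P-comm : ∀ p q → p +P q ≃ q +P p
+P-comm p q = coeffwise λ n → begin
  coeff (p +P q) n          ≡⟨ coeff-+P p q n ⟩
  coeff p n ℤ.+ coeff q n   ≡⟨ ℤ.+-comm (coeff p n) _ ⟩
  coeff q n ℤ.+ coeff p n   ≡⟨ coeff-+P q p n ⟨
  coeff (q +P p) n          ∎
  where open ≡-Reasoning

+P-assoc : ∀ p q r → (p +P q) +P r ≃ p +P (q +P r)
+P-assoc p q r = coeffwise λ n → begin
  coeff ((p +P q) +P r) n                        ≡⟨ coeff-+P (p +P q) r n ⟩
  coeff (p +P q) n ℤ.+ coeff r n                 ≡⟨ cong (ℤ._+ _) (coeff-+P p q n) ⟩
  coeff p n ℤ.+ coeff q n ℤ.+ coeff r n          ≡⟨ ℤ.+-assoc (coeff p n) _ _ ⟩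
  coeff p n ℤ.+ (coeff q n ℤ.+ coeff r n)        ≡⟨ cong (λ z → coeff p n ℤ.+ z) (coeff-+P q r n) ⟨
  coeff p n ℤ.+ coeff (q +P r) n                 ≡⟨ coeff-+P p (q +P r) n ⟨
  coeff (p +P (q +P r)) n                        ∎
  where open ≡-Reasoning

+P-identityʳ : ∀ p → p +P [] ≃ p
+P-identityʳ p = +P-comm p []

coeff--P : ∀ p n → coeff (-P p) n ≡ ℤ.- coeff p n
coeff--P = coeff-map ℤ.-_ refl

-P-cong : ∀ {p q} → p ≃ q → -P p ≃ -P q
-P-cong {p} {q} e = coeffwise λ n → begin
  coeff (-P p) n    ≡⟨ coeff--P p n ⟩
  ℤ.- coeff p n     ≡⟨ cong ℤ.-_ (coeff-≡ e n) ⟩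
  ℤ.- coeff q n     ≡⟨ coeff--P q n ⟨
  coeff (-P q) n    ∎
  where open ≡-Reasoning

-P-inverseʳ : ∀ p → p +P -P p ≃ []
-P-inverseʳ p = coeffwise λ n → begin
  coeff (p +P -P p) n              ≡⟨ coeff-+P p (-P p) n ⟩
  coeff p n ℤ.+ coeff (-P p) n     ≡⟨ cong (λ z → coeff p n ℤ.+ z) (coeff--P p n) ⟩
  coeff p n ℤ.+ ℤ.- coeff p n      ≡⟨ ℤ.+-inverseʳ (coeff p n) ⟩
  + 0                              ∎
  where open ≡-Reasoning

-P-inverseˡ : ∀ p → -P p +P p ≃ []
-P-inverseˡ p = ≃-trans (+P-comm (-P p) p) (-P-inverseʳ p)

+P-isAbelianGroup : IsAbelianGroup _≃_ _+P_ [] -P_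
+P-isAbelianGroup = record
  { isGroup = record
    { isMonoid = record
      { isSemigroup = record
        { isMagma = record
          { isEquivalence = record { refl = ≃-refl ; sym = ≃-sym ; trans = ≃-trans }
          ; ∙-cong = +P-cong }
        ; assoc = +P-assoc }
      ; identity = (λ _ → ≃-refl) , +P-identityʳ }
    ; inverse = -P-inverseˡ , -P-inverseʳ
    ; ⁻¹-cong = -P-cong }
  ; comm = +P-comm }

+P-abelianGroup : AbelianGroup 0ℓ 0ℓ
+P-abelianGroup = record { isAbelianGroup = +P-isAbelianGroup }

open AbelianGroup +P-abelianGroup using () renaming (setoid to ≃-setoid)
open CommutativeSemigroupProperties (AbelianGroup.commutativeSemigroup +P-abelianGroup)
  using (interchange; x∙yz≈y∙xz)
module ≃-Reasoning = SetoidReasoning ≃-setoid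

·P-cong : ∀ a {q q′} → q ≃ q′ → a ·P q ≃ a ·P q′
·P-cong a {q} {q′} e = coeffwise λ n → begin
  coeff (a ·P q) n     ≡⟨ coeff-·P a q n ⟩
  a ℤ.* coeff q n      ≡⟨ cong (a ℤ.*_) (coeff-≡ e n) ⟩
  a ℤ.* coeff q′ n     ≡⟨ coeff-·P a q′ n ⟨
  coeff (a ·P q′) n    ∎
  where open ≡-Reasoning

·P-distrib : ∀ a q r → a ·P (q +P r) ≃ a ·P q +P a ·P r
·P-distrib a q r = coeffwise λ n → begin
  coeff (a ·P (q +P r)) n                        ≡⟨ coeff-·P a (q +P r) n ⟩
  a ℤ.* coeff (q +P r) n                         ≡⟨ cong (a ℤ.*_) (coeff-+P q r n) ⟩
  a ℤ.* (coeff q n ℤ.+ coeff r n)                ≡⟨ ℤ.*-distribˡ-+ a (coeff q n) _ ⟩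
  a ℤ.* coeff q n ℤ.+ a ℤ.* coeff r n            ≡⟨ cong₂ ℤ._+_ (coeff-·P a q n) (coeff-·P a r n) ⟨
  coeff (a ·P q) n ℤ.+ coeff (a ·P r) n          ≡⟨ coeff-+P (a ·P q) (a ·P r) n ⟨
  coeff (a ·P q +P a ·P r) n                     ∎
  where open ≡-Reasoning

·P-assoc : ∀ a b q → (a ℤ.* b) ·P q ≃ a ·P (b ·P q)
·P-assoc a b q = coeffwise λ n → begin
  coeff ((a ℤ.* b) ·P q) n         ≡⟨ coeff-·P (a ℤ.* b) q n ⟩
  a ℤ.* b ℤ.* coeff q n            ≡⟨ ℤ.*-assoc a b _ ⟩
  a ℤ.* (b ℤ.* coeff q n)          ≡⟨ cong (a ℤ.*_) (coeff-·P b q n) ⟨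
  a ℤ.* coeff (b ·P q) n           ≡⟨ coeff-·P a (b ·P q) n ⟨
  coeff (a ·P (b ·P q)) n          ∎
  where open ≡-Reasoning

·P-zeroˡ : ∀ q → + 0 ·P q ≃ []
·P-zeroˡ q = coeffwise (coeff-·P (+ 0) q)

·P-identityˡ : ∀ q → + 1 ·P q ≃ q
·P-identityˡ q = coeffwise λ n → trans (coeff-·P (+ 1) q n) (ℤ.*-identityˡ _)

·P-shift : ∀ a s → a ·P (+ 0 ∷ s) ≃ + 0 ∷ a ·P s
·P-shift a s = ∷-cong (ℤ.*-zeroʳ a) ≃-refl

*P-zeroˡ : ∀ {p} q → p ≃ [] → p *P q ≃ []
*P-zeroˡ {[]}    q e = ≃-refl
*P-zeroˡ {a ∷ p} q e =
  +P-cong (≃-trans (≃-reflexive (cong (_·P q) (coeff-≡ e 0))) (·P-zeroˡ q))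
          (≃-trans (∷-cong refl (*P-zeroˡ q (≃[]-tail e))) 0∷[]≃[])

*P-zeroʳ : ∀ p → p *P [] ≃ []
*P-zeroʳ []      = ≃-refl
*P-zeroʳ (a ∷ p) = ≃-trans (∷-cong refl (*P-zeroʳ p)) 0∷[]≃[]

*P-congˡ : ∀ {p p′} q → p ≃ p′ → p *P q ≃ p′ *P q
*P-congˡ {[]}    {p′}     q e = ≃-sym (*P-zeroˡ q (≃-sym e))
*P-congˡ {a ∷ p} {[]}     q e = *P-zeroˡ q e
*P-congˡ {a ∷ p} {b ∷ p′} q e =
  +P-cong (≃-reflexive (cong (_·P q) (coeff-≡ e 0))) (∷-cong refl (*P-congˡ q (≃-tail e)))

*P-congʳ : ∀ p {q q′} → q ≃ q′ → p *P q ≃ p *P q′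
*P-congʳ []      e = ≃-refl
*P-congʳ (a ∷ p) e = +P-cong (·P-cong a e) (∷-cong refl (*P-congʳ p e))

*P-cong : ∀ {p p′ q q′} → p ≃ p′ → q ≃ q′ → p *P q ≃ p′ *P q′
*P-cong {p′ = p′} {q} e f = ≃-trans (*P-congˡ q e) (*P-congʳ p′ f)

*P-∷ʳ : ∀ p a q → p *P (a ∷ q) ≃ a ·P p +P (+ 0 ∷ p *P q)
*P-∷ʳ []      a q = ≃-sym 0∷[]≃[]
*P-∷ʳ (b ∷ p) a q = ∷-cong (cong (ℤ._+ + 0) (ℤ.*-comm b a)) (begin
  b ·P q +P p *P (a ∷ q)                       ≈⟨ +P-cong ≃-refl (*P-∷ʳ p a q) ⟩
  b ·P q +P (a ·P p +P (+ 0 ∷ p *P q))         ≈⟨ x∙yz≈y∙xz (b ·P q) (a ·P p) _ ⟩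
  a ·P p +P (b ·P q +P (+ 0 ∷ p *P q))         ∎)
  where open ≃-Reasoning

*P-comm : ∀ p q → p *P q ≃ q *P p
*P-comm []      q = ≃-sym (*P-zeroʳ q)
*P-comm (a ∷ p) q = ≃-trans (+P-cong ≃-refl (∷-cong refl (*P-comm p q))) (≃-sym (*P-∷ʳ q a p))

*P-distribˡ : ∀ p q r → p *P (q +P r) ≃ p *P q +P p *P r
*P-distribˡ []      q r = ≃-refl
*P-distribˡ (a ∷ p) q r = begin
  a ·P (q +P r) +P (+ 0 ∷ p *P (q +P r))
    ≈⟨ +P-cong (·P-distrib a q r) (∷-cong refl (*P-distribˡ p q r)) ⟩
  (a ·P q +P a ·P r) +P ((+ 0 ∷ p *P q) +P (+ 0 ∷ p *P r))
    ≈⟨ interchange (a ·P q) (a ·P r) _ _ ⟩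
  (a ·P q +P (+ 0 ∷ p *P q)) +P (a ·P r +P (+ 0 ∷ p *P r))
    ∎
  where open ≃-Reasoning

*P-distribʳ : ∀ p q r → (q +P r) *P p ≃ q *P p +P r *P p
*P-distribʳ p q r = begin
  (q +P r) *P p        ≈⟨ *P-comm (q +P r) p ⟩
  p *P (q +P r)        ≈⟨ *P-distribˡ p q r ⟩
  p *P q +P p *P r     ≈⟨ +P-cong (*P-comm p q) (*P-comm p r) ⟩
  q *P p +P r *P p     ∎
  where open ≃-Reasoning

·P-*P : ∀ a q r → (a ·P q) *P r ≃ a ·P (q *P r)
·P-*P a []      r = ≃-refl
·P-*P a (b ∷ q) r = begin
  (a ℤ.* b) ·P r +P (+ 0 ∷ (a ·P q) *P r)      ≈⟨ +P-cong (·P-assoc a b r) (∷-cong refl (·P-*P a q r)) ⟩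
  a ·P (b ·P r) +P (+ 0 ∷ a ·P (q *P r))       ≈⟨ +P-cong ≃-refl (≃-sym (·P-shift a (q *P r))) ⟩
  a ·P (b ·P r) +P a ·P (+ 0 ∷ q *P r)         ≈⟨ ≃-sym (·P-distrib a (b ·P r) _) ⟩
  a ·P (b ·P r +P (+ 0 ∷ q *P r))              ∎
  where open ≃-Reasoning

shift-*P : ∀ p r → (+ 0 ∷ p) *P r ≃ + 0 ∷ p *P r
shift-*P p r = +P-cong (·P-zeroˡ r) ≃-refl

*P-assoc : ∀ p q r → (p *P q) *P r ≃ p *P (q *P r)
*P-assoc []      q r = ≃-refl
*P-assoc (a ∷ p) q r = begin
  (a ·P q +P (+ 0 ∷ p *P q)) *P r              ≈⟨ *P-distribʳ r (a ·P q) _ ⟩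
  (a ·P q) *P r +P (+ 0 ∷ p *P q) *P r         ≈⟨ +P-cong (·P-*P a q r) (shift-*P (p *P q) r) ⟩
  a ·P (q *P r) +P (+ 0 ∷ (p *P q) *P r)       ≈⟨ +P-cong ≃-refl (∷-cong refl (*P-assoc p q r)) ⟩
  a ·P (q *P r) +P (+ 0 ∷ p *P (q *P r))       ∎
  where open ≃-Reasoning

*P-identityˡ : ∀ p → const (+ 1) *P p ≃ p
*P-identityˡ p = ≃-trans (+P-cong (·P-identityˡ p) 0∷[]≃[]) (+P-identityʳ p)

*P-identityʳ : ∀ p → p *P const (+ 1) ≃ p
*P-identityʳ p = ≃-trans (*P-comm p _) (*P-identityˡ p)

coeff-cons′ : ∀ a p n → coeff (cons′ a p) n ≡ coeff (a ∷ p) n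
coeff-cons′ (+ zero)  []      zero    = refl
coeff-cons′ (+ zero)  []      (suc n) = refl
coeff-cons′ (+ zero)  (x ∷ p) n       = refl
coeff-cons′ (+ suc m) p       n       = refl
coeff-cons′ -[1+ m ]  p       n       = refl

trim-≃ : ∀ p → trim p ≃ p
trim-≃ []      = ≃-refl
trim-≃ (a ∷ p) = ≃-trans (coeffwise (coeff-cons′ a (trim p))) (∷-cong refl (trim-≃ p))

≃[]⇒trim≡[] : ∀ p → p ≃ [] → trim p ≡ []
≃[]⇒trim≡[] []      e = refl
≃[]⇒trim≡[] (a ∷ p) e rewrite ≃[]⇒trim≡[] p (≃[]-tail e) | coeff-≡ e 0 = refl

≃⇒≈P : ∀ p q → p ≃ q → p ≈P q
≃⇒≈P []      q       e = sym (≃[]⇒trim≡[] q (≃-sym e))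
≃⇒≈P (a ∷ p) []      e = ≃[]⇒trim≡[] (a ∷ p) e
≃⇒≈P (a ∷ p) (b ∷ q) e = cong₂ cons′ (coeff-≡ e 0) (≃⇒≈P p q (≃-tail e))

≈P⇒≃ : ∀ {p q} → p ≈P q → p ≃ q
≈P⇒≃ {p} {q} e = ≃-trans (≃-sym (trim-≃ p)) (≃-trans (≃-reflexive e) (trim-≃ q))

cons′-∷ : ∀ a x xs → cons′ a (x ∷ xs) ≡ a ∷ x ∷ xs
cons′-∷ (+ zero)  x xs = refl
cons′-∷ (+ suc n) x xs = refl
cons′-∷ -[1+ n ]  x xs = refl

trim-∷ʳ : ∀ xs {a} → a ≢ + 0 → trim (xs ∷ʳ a) ≡ xs ∷ʳ a
trim-∷ʳ []           {+ zero}    a≢0 = ⊥-elim (a≢0 refl)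
trim-∷ʳ []           {+ suc n}   _   = refl
trim-∷ʳ []           { -[1+ n ]} _   = refl
trim-∷ʳ (x ∷ [])     a≢0 = trans (cong (cons′ x) (trim-∷ʳ [] a≢0)) (cons′-∷ x _ [])
trim-∷ʳ (x ∷ y ∷ xs) a≢0 = trans (cong (cons′ x) (trim-∷ʳ (y ∷ xs) a≢0)) (cons′-∷ x y _)

-- The zero test with which the ring solver cancels coefficients.
[]≃? : ∀ p → Maybe ([] ≃ p)
[]≃? p with trim p in eq
... | []    = just (≈P⇒≃ (sym eq))
... | _ ∷ _ = nothing

Poly-commutativeRing : CommutativeRing 0ℓ 0ℓ
Poly-commutativeRing = record
  { Carrier = Poly ; _≈_ = _≃_ ; _+_ = _+P_ ; _*_ = _*P_ ; -_ = -P_ ; 0# = [] ; 1# = const (+ 1)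
  ; isCommutativeRing = record
    { isRing = record
      { +-isAbelianGroup = +P-isAbelianGroup
      ; *-cong = *P-cong
      ; *-assoc = *P-assoc
      ; *-identity = *P-identityˡ , *P-identityʳ
      ; distrib = *P-distribˡ , *P-distribʳ }
    ; *-comm = *P-comm } }

Poly-ring : ACR.AlmostCommutativeRing 0ℓ 0ℓ
Poly-ring = ACR.fromCommutativeRing Poly-commutativeRing []≃?

open NonReflectiveRingSolver Poly-ring using (solve; _⊜_; Κ; _⊕_; _⊗_; ⊝_)

-- Degrees

record HasDegree (p : Poly) (d : ℕ) : Set where
  constructor hasDegree
  field
    lower     : Poly
    leading   : ℤ
    leading≢0 : leading ≢ + 0
    length≡   : length lower ≡ d
    ≃-lead    : p ≃ lower ∷ʳ leading

HasDegree-cong : ∀ {p q d} → p ≃ q → HasDegree p d → HasDegree q d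
HasDegree-cong p≃q (hasDegree xs a a≢0 len p≃) =
  hasDegree xs a a≢0 len (≃-trans (≃-sym p≃q) p≃)

length-∷ʳ : ∀ (xs : Poly) a → length (xs ∷ʳ a) ≡ suc (length xs)
length-∷ʳ []       a = refl
length-∷ʳ (x ∷ xs) a = cong suc (length-∷ʳ xs a)

degree-HasDegree : ∀ {p d} → HasDegree p d → degree p ≡ d
degree-HasDegree {p} (hasDegree xs a a≢0 refl p≃) = begin
  length (trim p) ∸ 1          ≡⟨ cong (λ t → length t ∸ 1) (≃⇒≈P p _ p≃) ⟩
  length (trim (xs ∷ʳ a)) ∸ 1  ≡⟨ cong (λ t → length t ∸ 1) (trim-∷ʳ xs a≢0) ⟩
  length (xs ∷ʳ a) ∸ 1         ≡⟨ cong (_∸ 1) (length-∷ʳ xs a) ⟩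
  length xs                    ∎
  where open ≡-Reasoning

HasDegree⇒≄[] : ∀ {p d} → HasDegree p d → ¬ p ≃ []
HasDegree⇒≄[] (hasDegree xs a a≢0 _ p≃) p≃[] =
  a≢0 (trans (sym (coeff-last xs)) (coeff-≡ (≃-trans (≃-sym p≃) p≃[]) (length xs)))
  where
  coeff-last : ∀ xs → coeff (xs ∷ʳ a) (length xs) ≡ a
  coeff-last []       = refl
  coeff-last (x ∷ xs) = coeff-last xs

≃[]⊎HasDegree : ∀ p → p ≃ [] ⊎ ∃ (HasDegree p)
≃[]⊎HasDegree []      = inj₁ ≃-refl
≃[]⊎HasDegree (a ∷ p) with ≃[]⊎HasDegree p
... | inj₂ (d , hasDegree xs b b≢0 len p≃) =
  inj₂ (suc d , hasDegree (a ∷ xs) b b≢0 (cong suc len) (∷-cong refl p≃))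
... | inj₁ p≃[] with a ℤ.≟ + 0
...   | yes refl = inj₁ (≃-trans (∷-cong refl p≃[]) 0∷[]≃[])
...   | no a≢0   = inj₂ (0 , hasDegree [] a a≢0 refl (∷-cong refl p≃[]))

HasDegree-∷ʳ : ∀ xs {a} → a ≢ + 0 → HasDegree (xs ∷ʳ a) (length xs)
HasDegree-∷ʳ xs a≢0 = hasDegree xs _ a≢0 refl ≃-refl

HasDegree-shift : ∀ {p d} → HasDegree p d → HasDegree (+ 0 ∷ p) (suc d)
HasDegree-shift (hasDegree xs a a≢0 len p≃) =
  hasDegree (+ 0 ∷ xs) a a≢0 (cong suc len) (∷-cong refl p≃)

HasDegree-·P : ∀ {a q d} → a ≢ + 0 → HasDegree q d → HasDegree (a ·P q) d
HasDegree-·P {a} a≢0 (hasDegree xs b b≢0 len q≃) =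
  hasDegree (a ·P xs) (a ℤ.* b) ab≢0 (trans (length-map _ xs) len)
            (≃-trans (·P-cong a q≃) (≃-reflexive (map-++ _ xs _)))
  where
  ab≢0 : a ℤ.* b ≢ + 0
  ab≢0 ab≡0 = [ a≢0 , b≢0 ]′ (ℤ.i*j≡0⇒i≡0∨j≡0 a ab≡0)

HasDegree-+P : ∀ {p d} u → length u ≤ d → HasDegree p d → HasDegree (u +P p) d
HasDegree-+P u u≤ (hasDegree xs a a≢0 refl p≃) =
  hasDegree (u +P xs) a a≢0 (length-+P u xs u≤)
            (≃-trans (+P-cong ≃-refl p≃) (≃-reflexive (+P-∷ʳ u xs u≤)))
  where
  +P-∷ʳ : ∀ u xs → length u ≤ length xs → u +P (xs ∷ʳ a) ≡ (u +P xs) ∷ʳ a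
  +P-∷ʳ []      xs       _         = refl
  +P-∷ʳ (b ∷ u) (x ∷ xs) (s≤s u≤) = cong (b ℤ.+ x ∷_) (+P-∷ʳ u xs u≤)
  length-+P : ∀ u xs → length u ≤ length xs → length (u +P xs) ≡ length xs
  length-+P []      xs       _         = refl
  length-+P (b ∷ u) (x ∷ xs) (s≤s u≤) = cong suc (length-+P u xs u≤)

∷ʳ-*P-∷ʳ-HasDegree : ∀ xs {a} ys {b} → a ≢ + 0 → b ≢ + 0 →
                     HasDegree ((xs ∷ʳ a) *P (ys ∷ʳ b)) (length xs + length ys)
∷ʳ-*P-∷ʳ-HasDegree [] ys a≢0 b≢0 =
  HasDegree-cong (≃-sym (≃-trans (+P-cong ≃-refl 0∷[]≃[]) (+P-identityʳ _)))
                 (HasDegree-·P a≢0 (HasDegree-∷ʳ ys b≢0))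
∷ʳ-*P-∷ʳ-HasDegree (x ∷ xs) {a} ys {b} a≢0 b≢0 =
  HasDegree-+P (x ·P (ys ∷ʳ b)) x·q≤ (HasDegree-shift (∷ʳ-*P-∷ʳ-HasDegree xs ys a≢0 b≢0))
  where
  x·q≤ : length (x ·P (ys ∷ʳ b)) ≤ suc (length xs + length ys)
  x·q≤ = begin
    length (x ·P (ys ∷ʳ b))   ≡⟨ length-map _ (ys ∷ʳ b) ⟩
    length (ys ∷ʳ b)          ≡⟨ length-∷ʳ ys b ⟩
    suc (length ys)           ≤⟨ s≤s (m≤n+m _ (length xs)) ⟩
    suc (length xs + length ys) ∎
    where open ≤-Reasoning

HasDegree-*P : ∀ {p q d e} → HasDegree p d → HasDegree q e → HasDegree (p *P q) (d + e)
HasDegree-*P (hasDegree xs a a≢0 refl p≃) (hasDegree ys b b≢0 refl q≃) =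
  HasDegree-cong (≃-sym (*P-cong p≃ q≃)) (∷ʳ-*P-∷ʳ-HasDegree xs ys a≢0 b≢0)

degree-*P-cancel : ∀ {p q r e f} → HasDegree q e → HasDegree r f →
                   p *P q ≃ r → degree p + e ≡ f
degree-*P-cancel {p} {q} {r} hq hr pq≃r with ≃[]⊎HasDegree p
... | inj₁ p≃[]     = ⊥-elim (HasDegree⇒≄[] hr (≃-trans (≃-sym pq≃r) (*P-zeroˡ q p≃[])))
... | inj₂ (d , hp) = begin
  degree p + _   ≡⟨ cong (_+ _) (degree-HasDegree hp) ⟩
  d + _          ≡⟨ degree-HasDegree (HasDegree-cong pq≃r (HasDegree-*P hp hq)) ⟨
  degree r       ≡⟨ degree-HasDegree hr ⟩
  _              ∎
  where open ≡-Reasoning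

-- Gaussian binomials

X^-+ : ∀ m n → X^ m *P X^ n ≃ X^ (m + n)
X^-+ zero    n = *P-identityˡ (X^ n)
X^-+ (suc m) n = ≃-trans (shift-*P (X^ m) (X^ n)) (∷-cong refl (X^-+ m n))

-- [a + b choose a] in q = p², by the q-Pascal rule.
gaussian : ℕ → ℕ → Poly
gaussian zero    b       = const (+ 1)
gaussian (suc a) zero    = const (+ 1)
gaussian (suc a) (suc b) = gaussian a (suc b) +P X^ (2 * suc a) *P gaussian (suc a) b

gaussian-prodP-fC : ∀ a b → gaussian a b *P prodP a fC *P prodP b fC ≃ prodP (a + b) fC
gaussian-prodP-fC zero b =
  ≃-trans (*P-congˡ (prodP b fC) (*P-identityˡ (const (+ 1)))) (*P-identityˡ (prodP b fC))
gaussian-prodP-fC (suc a) zero =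
  ≃-trans (*P-identityʳ (const (+ 1) *P prodP (suc a) fC))
    (≃-trans (*P-identityˡ (prodP (suc a) fC)) (≃-reflexive (cong C (sym (+-identityʳ (suc a))))))
  where C = λ n → prodP n fC
gaussian-prodP-fC (suc a) (suc b) = begin
  (G₁ +P x *P G₂) *P (C a *P u) *P (C b *P v)
    ≈⟨ expand G₁ G₂ (C a) (C b) x y ⟩
  u *P (G₁ *P C a *P C (suc b)) +P x *P v *P (G₂ *P C (suc a) *P C b)
    ≈⟨ +P-cong (*P-congʳ u (gaussian-prodP-fC a (suc b)))
               (*P-congʳ (x *P v) (gaussian-prodP-fC (suc a) b)) ⟩
  u *P C (a + suc b) +P x *P v *P D
    ≡⟨ cong (λ n → u *P C n +P x *P v *P D) (+-suc a b) ⟩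
  u *P D +P x *P v *P D
    ≈⟨ collect D x y ⟩
  D *P (x *P y +P -P 1P)
    ≈⟨ *P-congʳ D (+P-cong xy≃ (≃-refl { -P 1P})) ⟩
  C (suc (suc (a + b)))
    ≡⟨ cong C (+-suc (suc a) b) ⟨
  C (suc a + suc b)
    ∎
  where
  open ≃-Reasoning
  -- fC (suc a) is definitionally u, so prodP (suc a) fC is C a *P u.
  C = λ n → prodP n fC
  G₁ = gaussian a (suc b)
  G₂ = gaussian (suc a) b
  D = C (suc (a + b))
  1P = const (+ 1)
  x = X^ (2 * suc a)
  y = X^ (2 * suc b)
  u = x +P -P 1P
  v = y +P -P 1P
  exponent : ∀ m n → 2 * suc m + 2 * suc n ≡ 2 * suc (suc (m + n))
  exponent = solve-∀
  xy≃ : x *P y ≃ X^ (2 * suc (suc (a + b)))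
  xy≃ = ≃-trans (X^-+ (2 * suc a) (2 * suc b)) (≃-reflexive (cong X^ (exponent a b)))
  expand : ∀ G₁ G₂ A B x y →
           (G₁ +P x *P G₂) *P (A *P (x +P -P 1P)) *P (B *P (y +P -P 1P))
           ≃ (x +P -P 1P) *P (G₁ *P A *P (B *P (y +P -P 1P)))
             +P x *P (y +P -P 1P) *P (G₂ *P (A *P (x +P -P 1P)) *P B)
  expand = solve 6 (λ G₁ G₂ A B x y →
    (G₁ ⊕ x ⊗ G₂) ⊗ (A ⊗ (x ⊕ ⊝ Κ 1P)) ⊗ (B ⊗ (y ⊕ ⊝ Κ 1P))
    ⊜ ((x ⊕ ⊝ Κ 1P) ⊗ (G₁ ⊗ A ⊗ (B ⊗ (y ⊕ ⊝ Κ 1P)))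
       ⊕ x ⊗ (y ⊕ ⊝ Κ 1P) ⊗ (G₂ ⊗ (A ⊗ (x ⊕ ⊝ Κ 1P)) ⊗ B))) ≃-refl
  collect : ∀ D x y → (x +P -P 1P) *P D +P x *P (y +P -P 1P) *P D ≃ D *P (x *P y +P -P 1P)
  collect = solve 3 (λ D x y →
    ((x ⊕ ⊝ Κ 1P) ⊗ D ⊕ x ⊗ (y ⊕ ⊝ Κ 1P) ⊗ D) ⊜ D ⊗ (x ⊗ y ⊕ ⊝ Κ 1P)) ≃-refl

-- Degree arithmetic

sumTo : ℕ → (ℕ → ℕ) → ℕ
sumTo zero    d = 0
sumTo (suc n) d = sumTo n d + d n

triangle : ℕ → ℕ
triangle n = sumTo n suc

twice-triangle : ∀ n → 2 * triangle n ≡ n * suc n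
twice-triangle zero    = refl
twice-triangle (suc n) = begin
  2 * (triangle n + suc n)        ≡⟨ *-distribˡ-+ 2 (triangle n) (suc n) ⟩
  2 * triangle n + 2 * suc n      ≡⟨ cong (_+ 2 * suc n) (twice-triangle n) ⟩
  n * suc n + 2 * suc n           ≡⟨ step n ⟩
  suc n * suc (suc n)             ∎
  where
  open ≡-Reasoning
  step : ∀ n → n * suc n + 2 * suc n ≡ suc n * suc (suc n)
  step = solve-∀

-- The degree of L in terms of c and b = g − 2c.
degL : ℕ → ℕ → ℕ
degL c b = 2 * c * c + 4 * c * b + triangle b

twice-degL : ∀ c b → 2 * degL c b ≡ 4 * c * c + 8 * c * b + b * suc b
twice-degL c b = begin
  2 * (2 * c * c + 4 * c * b + triangle b)        ≡⟨ *-distribˡ-+ 2 (2 * c * c + 4 * c * b) _ ⟩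
  2 * (2 * c * c + 4 * c * b) + 2 * triangle b    ≡⟨ cong₂ _+_ (distrib c b) (twice-triangle b) ⟩
  4 * c * c + 8 * c * b + b * suc b               ∎
  where
  open ≡-Reasoning
  distrib : ∀ c b → 2 * (2 * c * c + 4 * c * b) ≡ 4 * c * c + 8 * c * b
  distrib = solve-∀

degL-+ : ∀ c b c′ b′ δ →
         4 * c * c + 8 * c * b + b * suc b ≡ 4 * c′ * c′ + 8 * c′ * b′ + b′ * suc b′ + 2 * δ →
         degL c b ≡ degL c′ b′ + δ
degL-+ c b c′ b′ δ e = *-cancelˡ-≡ _ _ 2 (begin
  2 * degL c b                                     ≡⟨ twice-degL c b ⟩
  4 * c * c + 8 * c * b + b * suc b                ≡⟨ e ⟩
  4 * c′ * c′ + 8 * c′ * b′ + b′ * suc b′ + 2 * δ  ≡⟨ cong (_+ 2 * δ) (twice-degL c′ b′) ⟨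
  2 * degL c′ b′ + 2 * δ                           ≡⟨ *-distribˡ-+ 2 (degL c′ b′) δ ⟨
  2 * (degL c′ b′ + δ)                             ∎)
  where open ≡-Reasoning

degFormula-2c+b : ∀ c b → degFormula (2 * c + b) c ≡ degL c b
degFormula-2c+b c b = begin
  (g * g + 4 * g * c + g ∸ k) / 2           ≡⟨ cong (λ n → (n ∸ k) / 2) numerator ⟩
  (k + 2 * degL c b ∸ k) / 2                 ≡⟨ cong (_/ 2) (m+n∸m≡n k (2 * degL c b)) ⟩
  2 * degL c b / 2                           ≡⟨ cong (_/ 2) (*-comm 2 (degL c b)) ⟩
  degL c b * 2 / 2                           ≡⟨ m*n/n≡m (degL c b) 2 ⟩
  degL c b                                   ∎
  where
  open ≡-Reasoning
  g = 2 * c + b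
  k = 8 * c * c + 2 * c
  expand : ∀ c b → (2 * c + b) * (2 * c + b) + 4 * (2 * c + b) * c + (2 * c + b)
                   ≡ 8 * c * c + 2 * c + (4 * c * c + 8 * c * b + b * suc b)
  expand = solve-∀
  numerator : g * g + 4 * g * c + g ≡ k + 2 * degL c b
  numerator = trans (expand c b) (cong (λ n → k + n) (sym (twice-degL c b)))

sumTo-2+4i : ∀ n → sumTo n (λ i → 2 + 4 * i) ≡ 2 * n * n
sumTo-2+4i zero    = refl
sumTo-2+4i (suc n) = trans (cong (_+ (2 + 4 * n)) (sumTo-2+4i n)) (step n)
  where
  step : ∀ n → 2 * n * n + (2 + 4 * n) ≡ 2 * suc n * suc n
  step = solve-∀

sumTo-2+2i : ∀ n → sumTo n (λ i → 2 * suc i) ≡ n * suc n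
sumTo-2+2i zero    = refl
sumTo-2+2i (suc n) = trans (cong (_+ 2 * suc n) (sumTo-2+2i n)) (step n)
  where
  step : ∀ n → n * suc n + 2 * suc n ≡ suc n * suc (suc n)
  step = solve-∀

degFormula-cancel : ∀ {g c d} → 2 * c ≤ g →
  d + (2 * c * suc (2 * c) + (g ∸ 2 * c) * suc (g ∸ 2 * c))
    ≡ triangle (g ∸ 2 * c) + 2 * c * c + g * suc g →
  d ≡ degFormula g c
degFormula-cancel {c = c} {d} 2c≤g e with m≤n⇒∃[o]m+o≡n 2c≤g
... | b , refl rewrite m+n∸m≡n (2 * c) b = begin
  d               ≡⟨ +-cancelʳ-≡ _ d (degL c b) (trans e (sym (balance c b (triangle b)))) ⟩
  degL c b        ≡⟨ degFormula-2c+b c b ⟨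
  degFormula (2 * c + b) c ∎
  where
  open ≡-Reasoning
  balance : ∀ c b t → 2 * c * c + 4 * c * b + t + (2 * c * suc (2 * c) + b * suc b)
                      ≡ t + 2 * c * c + (2 * c + b) * suc (2 * c + b)
  balance = solve-∀

degFormula-odd : ∀ {m c} → c ≤ m →
                 degFormula (2 * m + 1) c ≡ degFormula (2 * m + 1) 0 + c * suc (4 * (m ∸ c))
degFormula-odd {c = c} c≤m with m≤n⇒∃[o]m+o≡n c≤m
... | r , refl rewrite m+n∸m≡n c r = begin
  degFormula (2 * (c + r) + 1) c
    ≡⟨ cong (λ g → degFormula g c) (regroup c r) ⟩
  degFormula (2 * c + (2 * r + 1)) c
    ≡⟨ degFormula-2c+b c (2 * r + 1) ⟩
  degL c (2 * r + 1)
    ≡⟨ degL-+ c (2 * r + 1) 0 (2 * (c + r) + 1) (c * suc (4 * r)) (identity c r) ⟩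
  degL 0 (2 * (c + r) + 1) + c * suc (4 * r)
    ≡⟨ cong (_+ c * suc (4 * r)) (degFormula-2c+b 0 (2 * (c + r) + 1)) ⟨
  degFormula (2 * (c + r) + 1) 0 + c * suc (4 * r)
    ∎
  where
  open ≡-Reasoning
  regroup : ∀ c r → 2 * (c + r) + 1 ≡ 2 * c + (2 * r + 1)
  regroup = solve-∀
  identity : ∀ c r → 4 * c * c + 8 * c * (2 * r + 1) + (2 * r + 1) * suc (2 * r + 1)
                     ≡ (2 * (c + r) + 1) * suc (2 * (c + r) + 1) + 2 * (c * suc (4 * r))
  identity = solve-∀

degFormula-even : ∀ {m c} → c ≤ m →
                  degFormula (2 * m) c ≡ degFormula (2 * m) m + (m ∸ c) * suc (4 * c)
degFormula-even {c = c} c≤m with m≤n⇒∃[o]m+o≡n c≤m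
... | r , refl rewrite m+n∸m≡n c r = begin
  degFormula (2 * (c + r)) c
    ≡⟨ cong (λ g → degFormula g c) (*-distribˡ-+ 2 c r) ⟩
  degFormula (2 * c + 2 * r) c
    ≡⟨ degFormula-2c+b c (2 * r) ⟩
  degL c (2 * r)
    ≡⟨ degL-+ c (2 * r) (c + r) 0 (r * suc (4 * c)) (identity c r) ⟩
  degL (c + r) 0 + r * suc (4 * c)
    ≡⟨ cong (_+ r * suc (4 * c)) (degFormula-2c+b (c + r) 0) ⟨
  degFormula (2 * (c + r) + 0) (c + r) + r * suc (4 * c)
    ≡⟨ cong (λ g → degFormula g (c + r) + r * suc (4 * c)) (+-identityʳ (2 * (c + r))) ⟩
  degFormula (2 * (c + r)) (c + r) + r * suc (4 * c)
    ∎
  where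
  open ≡-Reasoning
  identity : ∀ c r → 4 * c * c + 8 * c * (2 * r) + 2 * r * suc (2 * r)
                     ≡ 4 * (c + r) * (c + r) + 8 * (c + r) * 0 + 0 * suc 0 + 2 * (r * suc (4 * c))
  identity = solve-∀

IsArgmin : (ℕ → ℕ) → ℕ → ℕ → Set
IsArgmin f n c = ∀ c′ → c′ ≤ n → f c ≤ f c′

IsArgmin⇔≡ : ∀ {f : ℕ → ℕ} {n c₀} (δ : ℕ → ℕ) → c₀ ≤ n →
             (∀ {c} → c ≤ n → f c ≡ f c₀ + δ c) →
             (∀ {c} → c ≤ n → δ c ≡ 0 → c ≡ c₀) →
             ∀ {c} → c ≤ n → IsArgmin f n c ⇔ c ≡ c₀
IsArgmin⇔≡ {f} {n} {c₀} δ c₀≤n split δ≡0⇒ {c} c≤n = mk⇔ to from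
  where
  to : IsArgmin f n c → c ≡ c₀
  to min = δ≡0⇒ c≤n (n≤0⇒n≡0 (+-cancelˡ-≤ (f c₀) (δ c) 0 (begin
    f c₀ + δ c   ≡⟨ split c≤n ⟨
    f c          ≤⟨ min c₀ c₀≤n ⟩
    f c₀         ≡⟨ +-identityʳ (f c₀) ⟨
    f c₀ + 0     ∎)))
    where open ≤-Reasoning
  from : c ≡ c₀ → IsArgmin f n c
  from refl c′ c′≤n = subst (f c ≤_) (sym (split c′≤n)) (m≤m+n (f c) (δ c′))

IsArgmin-odd : ∀ {g m c} → g ≡ 2 * m + 1 → c ≤ m → IsArgmin (degFormula g) m c ⇔ c ≡ 0
IsArgmin-odd {m = m} refl = IsArgmin⇔≡ (λ c → c * suc (4 * (m ∸ c))) z≤n degFormula-odd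
                                       (λ {c} _ → m*n≡0⇒m≡0 c _)

IsArgmin-even : ∀ {g m c} → g ≡ 2 * m → c ≤ m → IsArgmin (degFormula g) m c ⇔ c ≡ m
IsArgmin-even {m = m} refl = IsArgmin⇔≡ (λ c → (m ∸ c) * suc (4 * c)) ≤-refl degFormula-even
  (λ {c} c≤m δ≡0 → ≤-antisym c≤m (m∸n≡0⇒m≤n (m*n≡0⇒m≡0 (m ∸ c) _ δ≡0)))

m%2≡1⇒m≡2*[m/2]+1 : ∀ m → m % 2 ≡ 1 → m ≡ 2 * (m / 2) + 1
m%2≡1⇒m≡2*[m/2]+1 m m%2≡1 = begin
  m                   ≡⟨ m≡m%n+[m/n]*n m 2 ⟩
  m % 2 + m / 2 * 2   ≡⟨ cong (_+ m / 2 * 2) m%2≡1 ⟩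
  1 + m / 2 * 2       ≡⟨ +-comm 1 _ ⟩
  m / 2 * 2 + 1       ≡⟨ cong (_+ 1) (*-comm (m / 2) 2) ⟩
  2 * (m / 2) + 1     ∎
  where open ≡-Reasoning

m%2≡0⇒m≡2*[m/2] : ∀ m → m % 2 ≡ 0 → m ≡ 2 * (m / 2)
m%2≡0⇒m≡2*[m/2] m m%2≡0 = begin
  m                   ≡⟨ m≡m%n+[m/n]*n m 2 ⟩
  m % 2 + m / 2 * 2   ≡⟨ cong (_+ m / 2 * 2) m%2≡0 ⟩
  m / 2 * 2           ≡⟨ *-comm (m / 2) 2 ⟩
  2 * (m / 2)         ∎
  where open ≡-Reasoning

m≤n/2⇒2*m≤n : ∀ {m} n → m ≤ n / 2 → 2 * m ≤ n
m≤n/2⇒2*m≤n {m} n m≤n/2 = begin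
  2 * m         ≤⟨ *-monoʳ-≤ 2 m≤n/2 ⟩
  2 * (n / 2)   ≡⟨ *-comm 2 (n / 2) ⟩
  n / 2 * 2     ≤⟨ m/n*n≤m n 2 ⟩
  n             ∎
  where open ≤-Reasoning

-- The polynomial L

HasDegree-prodP : ∀ n {f} (d : ℕ → ℕ) → (∀ i → HasDegree (f (suc i)) (d i)) →
                  HasDegree (prodP n f) (sumTo n d)
HasDegree-prodP zero    d h = HasDegree-∷ʳ [] (λ ())
HasDegree-prodP (suc n) d h = HasDegree-*P (HasDegree-prodP n d h) (h n)

HasDegree-X^+const : ∀ m s .{{_ : NonZero m}} → HasDegree (X^ m +P const s) m
HasDegree-X^+const (suc k) s = hasDegree (+ 0 ℤ.+ s ∷ replicate k (+ 0)) (+ 1) (λ ())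
  (cong suc (length-replicate k)) (∷-cong refl (+P-identityʳ _))

HasDegree-prodP-fA : ∀ n → HasDegree (prodP n fA) (triangle n)
HasDegree-prodP-fA n = HasDegree-prodP n suc (λ i → HasDegree-X^+const (suc i) (negOnePow (suc i)))

HasDegree-prodP-fB : ∀ n → HasDegree (prodP n fB) (2 * n * n)
HasDegree-prodP-fB n = subst (HasDegree _) (sumTo-2+4i n) (HasDegree-prodP n (λ i → 2 + 4 * i) fB-degree)
  where
  regroup : ∀ i → 4 * suc i ≡ 2 + (2 + 4 * i)
  regroup = solve-∀
  exponent : ∀ i → 4 * suc i ∸ 2 ≡ 2 + 4 * i
  exponent i = trans (cong (_∸ 2) (regroup i)) (m+n∸m≡n 2 (2 + 4 * i))
  fB-degree : ∀ i → HasDegree (fB (suc i)) (2 + 4 * i)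
  fB-degree i = subst (λ k → HasDegree (X^ k +P const (- (+ 1))) (2 + 4 * i)) (sym (exponent i))
                      (HasDegree-X^+const (2 + 4 * i) (- (+ 1)))

HasDegree-prodP-fC : ∀ n → HasDegree (prodP n fC) (n * suc n)
HasDegree-prodP-fC n = subst (HasDegree _) (sumTo-2+2i n)
  (HasDegree-prodP n (λ i → 2 * suc i) (λ i → HasDegree-X^+const (2 * suc i) (- (+ 1))))

Lwitness : ℕ → ℕ → Poly
Lwitness c b = prodP b fA *P prodP c fB *P gaussian (2 * c) b

IsL-Lwitness : ∀ g c → 2 * c ≤ g → IsL g c (Lwitness c (g ∸ 2 * c))
IsL-Lwitness g c 2c≤g = ≃⇒≈P _ _ (begin
  A *P B *P G *P (C (2 * c) *P C b)      ≈⟨ *P-assoc (A *P B) G _ ⟩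
  A *P B *P (G *P (C (2 * c) *P C b))    ≈⟨ *P-congʳ (A *P B) (≃-sym (*P-assoc G _ _)) ⟩
  A *P B *P (G *P C (2 * c) *P C b)      ≈⟨ *P-congʳ (A *P B) (gaussian-prodP-fC (2 * c) b) ⟩
  A *P B *P C (2 * c + b)                ≡⟨ cong (λ n → A *P B *P C n) (m+[n∸m]≡n 2c≤g) ⟩
  A *P B *P C g                          ∎)
  where
  open ≃-Reasoning
  b = g ∸ 2 * c
  A = prodP b fA
  B = prodP c fB
  G = gaussian (2 * c) b
  C = λ n → prodP n fC

degree-IsL : ∀ g c L → 2 * c ≤ g → IsL g c L → degree L ≡ degFormula g c
degree-IsL g c L 2c≤g isL = degFormula-cancel {g} {c} 2c≤g (degree-*P-cancel {L}
  (HasDegree-*P (HasDegree-prodP-fC (2 * c)) (HasDegree-prodP-fC b))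
  (HasDegree-*P (HasDegree-*P (HasDegree-prodP-fA b) (HasDegree-prodP-fB c)) (HasDegree-prodP-fC g))
  (≈P⇒≃ isL))
  where b = g ∸ 2 * c

IsL-exists : ∀ g c → c ≤ g / 2 → Σ Poly (λ L → IsL g c L × degree L ≡ degFormula g c)
IsL-exists g c c≤g/2 = L , isL , degree-IsL g c L 2c≤g isL
  where
  2c≤g = m≤n/2⇒2*m≤n g c≤g/2
  L = Lwitness c (g ∸ 2 * c)
  isL = IsL-Lwitness g c 2c≤g

MinDeg⇔IsArgmin : ∀ g c → c ≤ g / 2 → MinDeg g c ⇔ IsArgmin (degFormula g) (g / 2) c
MinDeg⇔IsArgmin g c c≤g/2 = mk⇔ to from
  where
  to : MinDeg g c → IsArgmin (degFormula g) (g / 2) c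
  to min c′ c′≤g/2 with IsL-exists g c c≤g/2 | IsL-exists g c′ c′≤g/2
  ... | L , isL , deg-L | L′ , isL′ , deg-L′ = subst₂ _≤_ deg-L deg-L′ (min L isL c′ c′≤g/2 L′ isL′)
  degree-L : ∀ {c′} L → c′ ≤ g / 2 → IsL g c′ L → degree L ≡ degFormula g c′
  degree-L {c′} L c′≤g/2 = degree-IsL g c′ L (m≤n/2⇒2*m≤n g c′≤g/2)
  from : IsArgmin (degFormula g) (g / 2) c → MinDeg g c
  from min L isL c′ c′≤g/2 L′ isL′ =
    subst₂ _≤_ (sym (degree-L L c≤g/2 isL)) (sym (degree-L L′ c′≤g/2 isL′)) (min c′ c′≤g/2)

lemma3p2 : (g : ℕ) → 1 ≤ g →
    ((c : ℕ) → c ≤ g / 2 → Σ Poly (λ L → IsL g c L × degree L ≡ degFormula g c))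
    × (g % 2 ≡ 1 → (c : ℕ) → c ≤ g / 2 → (MinDeg g c ⇔ c ≡ 0))
    × (g % 2 ≡ 0 → (c : ℕ) → c ≤ g / 2 → (MinDeg g c ⇔ c ≡ g / 2))
lemma3p2 g _ = IsL-exists g , odd , even
  where
  odd : g % 2 ≡ 1 → (c : ℕ) → c ≤ g / 2 → (MinDeg g c ⇔ c ≡ 0)
  odd g%2≡1 c c≤g/2 =
    ⇔-trans (MinDeg⇔IsArgmin g c c≤g/2) (IsArgmin-odd (m%2≡1⇒m≡2*[m/2]+1 g g%2≡1) c≤g/2)
  even : g % 2 ≡ 0 → (c : ℕ) → c ≤ g / 2 → (MinDeg g c ⇔ c ≡ g / 2)
  even g%2≡0 c c≤g/2 =
    ⇔-trans (MinDeg⇔IsArgmin g c c≤g/2) (IsArgmin-even (m%2≡0⇒m≡2*[m/2] g g%2≡0) c≤g/2)
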